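{- Let $A$ be a finite non-empty alphabet, let $\lambda$ be a left-infinite word and $\rho$ a right-infinite word over $A$. For every $n\in\mathbb{N}$, $$log(\lambda_{n+1},\rho_{n+1})\in\{0,\ log(\lambda_n,\rho_n)+1\}\quad\text{and}\quad rog(\lambda_{n+1},\rho_{n+1})\geq rog(\lambda_n,\rho_n)-1.$$
   Context: $\mathbb{N}=\{0,1,2,\dots\}$. A left-infinite word is a sequence $\cdots a_{ -2}a_{ -1}a_0$ of letters indexed by $-\mathbb{N}$; a right-infinite word is a sequence $a_0a_1a_2\cdots$ indexed by $\mathbb{N}$. For $n\in\mathbb{N}$, $\lambda_n$ is the suffix of length $n$ of $\lambda$ and $\rho_n$ the prefix of length $n$ of $\rho$. For finite words $u,v$ of equal length: $log(u,v)=\min\{n\in\mathbb{N}: ux=x'v \text{ for some words } x,x' \text{ of length } n\}$ and $rog(u,v)=\min\{n\in\mathbb{N}: xu=vx' \text{ for some words } x,x' \text{ of length } n\}$. -}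

module Defs where

open import Data.Nat using (ℕ; zero; suc; _≤_)
open import Data.List using (List; []; _∷_; _++_; length)
open import Data.Product using (Σ; _×_; ∃-syntax)
open import Relation.Binary.PropositionalEquality using (_≡_)

-- A left-infinite word  ⋯ a₋₂ a₋₁ a₀  is represented by  lw : ℕ → A  with  lw i = a₋ᵢ.
LeftWord : Set → Set
LeftWord A = ℕ → A

RightWord : Set → Set
RightWord A = ℕ → A

suffix : {A : Set} → LeftWord A → ℕ → List A
suffix lw zero    = []
suffix lw (suc n) = lw n ∷ suffix lw n

prefix : {A : Set} → RightWord A → ℕ → List A
prefix rw zero    = []
prefix rw (suc n) = rw zero ∷ prefix (λ i → rw (suc i)) n

LogSet : {A : Set} → List A → List A → ℕ → Set
LogSet {A} u v n = ∃[ x ] ∃[ x' ] (length {A = A} x ≡ n × length {A = A} x' ≡ n × u ++ x ≡ x' ++ v)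

RogSet : {A : Set} → List A → List A → ℕ → Set
RogSet {A} u v n = ∃[ x ] ∃[ x' ] (length {A = A} x ≡ n × length {A = A} x' ≡ n × x ++ u ≡ v ++ x')

IsMin : (ℕ → Set) → ℕ → Set
IsMin P m = P m × (∀ k → P k → m ≤ k)

-- log(u,v) = m  and  rog(u,v) = m, stated relationally (the minimum always exists for |u| = |v|)
IsLog : {A : Set} → List A → List A → ℕ → Set
IsLog u v m = IsMin (LogSet u v) m

IsRog : {A : Set} → List A → List A → ℕ → Set
IsRog u v m = IsMin (RogSet u v) m

-- Write λ_{n+1} = c λ_n and ρ_{n+1} = ρ_n d. A witness u x = x' v of size b extends to
-- c u (x d) = (c x') (v d) of size b + 1, and conversely a witness of size b + 1 for the
-- longer pair loses its first and last letter to one of size b for the shorter pair;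
-- so a nonzero log(c u, v d) equals log(u, v) + 1. For rog only the extension direction
-- is available: (x c) u = v (d x') turns a witness of size a for the longer pair into one
-- of size a + 1 for the shorter pair, whence rog(u, v) ≤ rog(c u, v d) + 1.
module Submission where

open import Defs
open import Data.Nat using (ℕ; zero; suc; _+_; _∸_; _≤_; s≤s; pred)
open import Data.Nat.Properties using (≤-antisym; +-comm; ∸-monoˡ-≤)
open import Data.Fin using (Fin)
open import Data.List using (List; []; _∷_; _++_; _∷ʳ_; length; initLast; _∷ʳ′_)
open import Data.List.Properties using (++-assoc; ∷ʳ-injectiveˡ; ∷-injectiveʳ)
open import Data.Sum using (_⊎_; inj₁; inj₂)
open import Data.Product using (_×_; _,_)
open import Function.Bundles using (_↔_)
open import Relation.Binary.PropositionalEquality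
  using (_≡_; refl; sym; trans; cong; subst; module ≡-Reasoning)

private
  variable
    A : Set

length-∷ʳ : (xs : List A) (x : A) → length (xs ∷ʳ x) ≡ suc (length xs)
length-∷ʳ []       x = refl
length-∷ʳ (_ ∷ xs) x = cong suc (length-∷ʳ xs x)

prefix-suc : (rw : RightWord A) (n : ℕ) → prefix rw (suc n) ≡ prefix rw n ∷ʳ rw n
prefix-suc rw zero    = refl
prefix-suc rw (suc n) = cong (rw zero ∷_) (prefix-suc (λ i → rw (suc i)) n)

logSet-extend : (c d : A) (u v : List A) {b : ℕ} →
  LogSet u v b → LogSet (c ∷ u) (v ∷ʳ d) (suc b)
logSet-extend c d u v (x , x' , lx , lx' , ux≡x'v) =
  x ∷ʳ d , c ∷ x' , trans (length-∷ʳ x d) (cong suc lx) , cong suc lx' ,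
  cong (c ∷_) (begin
    u ++ x ∷ʳ d    ≡⟨ sym (++-assoc u x _) ⟩
    (u ++ x) ∷ʳ d  ≡⟨ cong (_∷ʳ d) ux≡x'v ⟩
    (x' ++ v) ∷ʳ d ≡⟨ ++-assoc x' v _ ⟩
    x' ++ v ∷ʳ d   ∎)
  where open ≡-Reasoning

logSet-shrink : (c d : A) (u v : List A) {a : ℕ} →
  LogSet (c ∷ u) (v ∷ʳ d) (suc a) → LogSet u v a
logSet-shrink c d u v (x , x' , lx , lx' , cux≡x'vd) with initLast x | x'
... | []      | _      with () ← lx
... | _       | []     with () ← lx'
... | z ∷ʳ′ f | e ∷ y' = z , y' , cong pred (trans (sym (length-∷ʳ z f)) lx) ,
  cong pred lx' , ∷ʳ-injectiveˡ (u ++ z) (y' ++ v) (begin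
    (u ++ z) ∷ʳ f  ≡⟨ ++-assoc u z _ ⟩
    u ++ z ∷ʳ f    ≡⟨ ∷-injectiveʳ cux≡x'vd ⟩
    y' ++ v ∷ʳ d   ≡⟨ sym (++-assoc y' v _) ⟩
    (y' ++ v) ∷ʳ d ∎)
  where open ≡-Reasoning

rogSet-extend : (c d : A) (u v : List A) {a : ℕ} →
  RogSet (c ∷ u) (v ∷ʳ d) a → RogSet u v (suc a)
rogSet-extend c d u v (x , x' , lx , lx' , xcu≡vdx') =
  x ∷ʳ c , d ∷ x' , trans (length-∷ʳ x c) (cong suc lx) , cong suc lx' ,
  (begin
    x ∷ʳ c ++ u  ≡⟨ ++-assoc x _ u ⟩
    x ++ c ∷ u   ≡⟨ xcu≡vdx' ⟩
    v ∷ʳ d ++ x' ≡⟨ ++-assoc v _ x' ⟩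
    v ++ d ∷ x'  ∎)
  where open ≡-Reasoning

isLog-extend : (c d : A) (u v : List A) (a b : ℕ) →
  IsLog (c ∷ u) (v ∷ʳ d) a → IsLog u v b → a ≡ 0 ⊎ a ≡ b + 1
isLog-extend c d u v zero    b _             _             = inj₁ refl
isLog-extend c d u v (suc a) b (la , a-least) (lb , b-least) = inj₂ (trans
  (≤-antisym (a-least (suc b) (logSet-extend c d u v lb))
             (s≤s (b-least a (logSet-shrink c d u v la))))
  (+-comm 1 b))

isRog-extend : (c d : A) (u v : List A) (a b : ℕ) →
  IsRog (c ∷ u) (v ∷ʳ d) a → IsRog u v b → b ∸ 1 ≤ a
isRog-extend c d u v a b (ra , _) (_ , b-least) =
  ∸-monoˡ-≤ 1 (b-least (suc a) (rogSet-extend c d u v ra))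

lemma2p2 : (A : Set) (k : ℕ) → A ↔ Fin (suc k) →
    (lw : LeftWord A) (rw : RightWord A) (n : ℕ) →
    (∀ a b → IsLog (suffix lw (suc n)) (prefix rw (suc n)) a →
             IsLog (suffix lw n) (prefix rw n) b →
             a ≡ 0 ⊎ a ≡ b + 1)
    × (∀ a b → IsRog (suffix lw (suc n)) (prefix rw (suc n)) a →
               IsRog (suffix lw n) (prefix rw n) b →
               b ∸ 1 ≤ a)
lemma2p2 A k _ lw rw n = log-step , rog-step
  where
  λₙ ρₙ : List A
  λₙ = suffix lw n
  ρₙ = prefix rw n

  ρₙd≡ρₙ₊₁ : prefix rw n ∷ʳ rw n ≡ prefix rw (suc n)
  ρₙd≡ρₙ₊₁ = sym (prefix-suc rw n)

  log-step : ∀ a b → IsLog (lw n ∷ λₙ) (prefix rw (suc n)) a → IsLog λₙ ρₙ b →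
             a ≡ 0 ⊎ a ≡ b + 1
  log-step = subst (λ ρ → ∀ a b → IsLog (lw n ∷ λₙ) ρ a → IsLog λₙ ρₙ b → a ≡ 0 ⊎ a ≡ b + 1)
    ρₙd≡ρₙ₊₁ (isLog-extend (lw n) (rw n) λₙ ρₙ)

  rog-step : ∀ a b → IsRog (lw n ∷ λₙ) (prefix rw (suc n)) a → IsRog λₙ ρₙ b → b ∸ 1 ≤ a
  rog-step = subst (λ ρ → ∀ a b → IsRog (lw n ∷ λₙ) ρ a → IsRog λₙ ρₙ b → b ∸ 1 ≤ a)
    ρₙd≡ρₙ₊₁ (isRog-extend (lw n) (rw n) λₙ ρₙ)
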